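{- Let $\Lambda,\Gamma$ be $k$-graphs, and let $\varphi,\psi:\Lambda\to\Gamma$ be $k$-graph morphisms such that $\tilde\varphi=\tilde\psi$ as maps $X_\Lambda\to X_\Gamma$. Then $\varphi=\psi$.
   Context: A $k$-graph is a countable small category with a degree functor $d:\Lambda\to\mathbb{N}^k$ satisfying unique factorization: whenever $d(\lambda)=m+n$, there are unique $\mu,\nu$ with $d(\mu)=m$, $d(\nu)=n$ and $\lambda=\mu\nu$. A morphism is a degree-preserving functor. $X_\Lambda$ is the quotient of $\bigsqcup_\lambda\{\lambda\}\times[0,d(\lambda)]$ by $(\mu,s)\sim(\nu,t)$ if and only if $\mu(\lfloor s\rfloor,\lceil s\rceil)=\nu(\lfloor t\rfloor,\lceil t\rceil)$ and $s-\lfloor s\rfloor=t-\lfloor t\rfloor$, where $\lfloor\cdot\rfloor,\lceil\cdot\rceil$ are the coordinatewise floor and ceiling and $\lambda(m,n)$ is the factor of degree $n-m$ starting at position $m$. For a morphism $\varphi$, $\tilde\varphi([\lambda,t])=[\varphi(\lambda),t]$. -}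

module Defs where

open import Data.Nat using (ℕ)
import Data.Nat as ℕ
open import Data.Fin using (Fin)
open import Data.Vec using (Vec; zipWith; replicate; lookup; map)
open import Data.Integer using (∣_∣) renaming (+_ to ℤ+)
open import Data.Rational using (ℚ; floor; ceiling; _-_; _/_; _≤_; 0ℚ)
import Data.Rational as ℚ
open import Data.Product using (Σ; Σ-syntax; _×_; _,_)
open import Function.Definitions using (Injective)
open import Relation.Binary.PropositionalEquality using (_≡_)

_⊕_ : ∀ {k} → Vec ℕ k → Vec ℕ k → Vec ℕ k
_⊕_ = zipWith ℕ._+_

-- Composition is written in the
-- usual (function-composition) order: μ ∘ ν is defined when s(μ) = r(ν),
-- with  ν : Hom a b, μ : Hom b c.
record KGraph (k : ℕ) : Set₁ where
  infixr 9 _∘_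
  field
    Obj : Set
    Hom : Obj → Obj → Set
    id  : ∀ {a} → Hom a a
    _∘_ : ∀ {a b c} → Hom b c → Hom a b → Hom a c
    identityˡ : ∀ {a b} (f : Hom a b) → id ∘ f ≡ f
    identityʳ : ∀ {a b} (f : Hom a b) → f ∘ id ≡ f
    assoc : ∀ {a b c e} (f : Hom c e) (g : Hom b c) (h : Hom a b) →
            (f ∘ g) ∘ h ≡ f ∘ (g ∘ h)
    d : ∀ {a b} → Hom a b → Vec ℕ k
    d-id : ∀ {a} → d (id {a}) ≡ replicate k 0
    d-∘ : ∀ {a b c} (μ : Hom b c) (ν : Hom a b) → d (μ ∘ ν) ≡ d μ ⊕ d ν

  Mor : Set
  Mor = Σ[ a ∈ Obj ] Σ[ b ∈ Obj ] Hom a b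

  Factorisation : ∀ {a c} → Hom a c → Vec ℕ k → Vec ℕ k → Set
  Factorisation {a} {c} λ' m n =
    Σ[ b ∈ Obj ] Σ[ μ ∈ Hom b c ] Σ[ ν ∈ Hom a b ]
      (d μ ≡ m × d ν ≡ n × μ ∘ ν ≡ λ')

  field
    countable : Σ[ f ∈ (Mor → ℕ) ] Injective _≡_ _≡_ f
    factor : ∀ {a c} (λ' : Hom a c) (m n : Vec ℕ k) → d λ' ≡ m ⊕ n →
             Factorisation λ' m n
    factor-unique : ∀ {a c} (λ' : Hom a c) (m n : Vec ℕ k)
                    (F G : Factorisation λ' m n) →
                    (Σ.proj₁ F , Σ.proj₁ (Σ.proj₂ F) , Σ.proj₁ (Σ.proj₂ (Σ.proj₂ F)))
                    ≡ (Σ.proj₁ G , Σ.proj₁ (Σ.proj₂ G) , Σ.proj₁ (Σ.proj₂ (Σ.proj₂ G)))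

  -- β is the segment λ(m,n): λ = α ∘ β ∘ γ with d α = m and d α + d β = n
  IsSeg : ∀ {a c} → Hom a c → Vec ℕ k → Vec ℕ k → Mor → Set
  IsSeg {a} {c} λ' m n (x , y , β) =
    Σ[ α ∈ Hom y c ] Σ[ γ ∈ Hom a x ]
      (d α ≡ m × m ⊕ d β ≡ n × α ∘ (β ∘ γ) ≡ λ')

open KGraph public

record KMorphism {k} (Λ Γ : KGraph k) : Set where
  field
    F₀ : Obj Λ → Obj Γ
    F₁ : ∀ {a b} → Hom Λ a b → Hom Γ (F₀ a) (F₀ b)
    F-id : ∀ {a} → F₁ (id Λ {a}) ≡ id Γ
    F-∘ : ∀ {a b c} (μ : Hom Λ b c) (ν : Hom Λ a b) →
          F₁ (_∘_ Λ μ ν) ≡ _∘_ Γ (F₁ μ) (F₁ ν)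
    F-d : ∀ {a b} (λ' : Hom Λ a b) → d Γ (F₁ λ') ≡ d Λ λ'

open KMorphism public

-- coordinatewise floor, ceiling, fractional part (points have t ≥ 0)
⌊_⌋ᵛ : ∀ {k} → Vec ℚ k → Vec ℕ k
⌊ t ⌋ᵛ = map (λ q → ∣ floor q ∣) t

⌈_⌉ᵛ : ∀ {k} → Vec ℚ k → Vec ℕ k
⌈ t ⌉ᵛ = map (λ q → ∣ ceiling q ∣) t

frac : ∀ {k} → Vec ℚ k → Vec ℚ k
frac t = map (λ q → q - (floor q / 1)) t

InBox : ∀ {k} → Vec ℚ k → Vec ℕ k → Set
InBox {k} t n = ∀ (i : Fin k) → 0ℚ ≤ lookup t i × lookup t i ≤ (ℤ+ (lookup n i) / 1)

-- the relation defining X_Λ: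
-- (μ,s) ∼ (ν,t) iff μ(⌊s⌋,⌈s⌉) = ν(⌊t⌋,⌈t⌉) and s - ⌊s⌋ = t - ⌊t⌋
Rel∼ : ∀ {k} (Λ : KGraph k) → Mor Λ → Vec ℚ k → Mor Λ → Vec ℚ k → Set
Rel∼ Λ (a , c , μ) s (a' , c' , ν) t =
  Σ[ β ∈ Mor Λ ] (IsSeg Λ μ ⌊ s ⌋ᵛ ⌈ s ⌉ᵛ β × IsSeg Λ ν ⌊ t ⌋ᵛ ⌈ t ⌉ᵛ β)
  × frac s ≡ frac t

-- φ̃ = ψ̃ : X_Λ → X_Γ, i.e. [φ(λ),t] = [ψ(λ),t] for every point [λ,t]
TildeEq : ∀ {k} {Λ Γ : KGraph k} → KMorphism Λ Γ → KMorphism Λ Γ → Set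
TildeEq {k} {Λ} {Γ} φ ψ =
  ∀ {a b} (λ' : Hom Λ a b) (t : Vec ℚ k) → InBox t (d Λ λ') →
    Rel∼ Γ (F₀ φ a , F₀ φ b , F₁ φ λ') t (F₀ ψ a , F₀ ψ b , F₁ ψ λ') t

MorphEq : ∀ {k} {Λ Γ : KGraph k} → KMorphism Λ Γ → KMorphism Λ Γ → Set
MorphEq {k} {Λ} {Γ} φ ψ =
  (∀ (a : Obj Λ) → F₀ φ a ≡ F₀ ψ a) ×
  (∀ {a b} (λ' : Hom Λ a b) →
     _≡_ {A = Mor Γ} (F₀ φ a , F₀ φ b , F₁ φ λ') (F₀ ψ a , F₀ ψ b , F₁ ψ λ'))

module Submission where

-- Let λ be a morphism of Λ whose degree lies in {0,1}^k and let
-- t ∈ [0, d(λ)] be its "midpoint": tᵢ = ½ where d(λ)ᵢ = 1 and tᵢ = 0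
-- otherwise.  Then ⌊t⌋ = 0 and ⌈t⌉ = d(λ), so the point [φ(λ), t] of X_Γ
-- only remembers the segment φ(λ)(0, d(λ)) = φ(λ).  Hence φ̃ = ψ̃ forces
-- φ(λ) = ψ(λ) on all such "unit" morphisms.  An arbitrary morphism is
-- a composite of unit morphisms (peel off the factor of degree
-- min(1, d(λ)) repeatedly), so two functors agreeing on unit morphisms
-- agree everywhere; objects are recovered from their identity morphisms.

open import Defs
open import Data.Nat using (ℕ; zero; suc; _≤_; z≤n; s≤s; _∸_; _⊓_)
open import Data.Nat.Properties
  using (+-identityˡ; +-identityʳ; +-cancelˡ-≡; m⊓n≤m; m⊓n+n∸m≡n; ∸-monoˡ-≤;
         m≤m+n; m≤n+m; ≤-trans; n≤1+n)
open import Data.Vec using (Vec; []; _∷_; map; replicate; sum; head; tail)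
open import Data.Vec.Properties using (zipWith-identityˡ; zipWith-identityʳ)
open import Data.Vec.Relation.Unary.All using (All; []; _∷_)
import Data.Vec.Relation.Unary.All as All
open import Data.Vec.Relation.Unary.All.Properties using (map⁺)
import Data.Fin as Fin
open import Data.Unit using (tt)
open import Data.Product using (_,_; proj₁)
open import Data.Rational using (ℚ; ½; 0ℚ; 1ℚ)
import Data.Rational.Properties as ℚ
open import Relation.Nullary.Decidable using (toWitness)
open import Relation.Binary.PropositionalEquality

0⊕ : ∀ {k} (v : Vec ℕ k) → replicate k 0 ⊕ v ≡ v
0⊕ = zipWith-identityˡ +-identityˡ

⊕0 : ∀ {k} (v : Vec ℕ k) → v ⊕ replicate k 0 ≡ v
⊕0 = zipWith-identityʳ +-identityʳ

⊕-cancelˡ : ∀ {k} (u : Vec ℕ k) {v w : Vec ℕ k} → u ⊕ v ≡ u ⊕ w → v ≡ w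
⊕-cancelˡ []      {[]}    {[]}    _ = refl
⊕-cancelˡ (x ∷ u) {y ∷ v} {z ∷ w} e =
  cong₂ _∷_ (+-cancelˡ-≡ x y z (cong head e))
            (⊕-cancelˡ u (cong tail e))

unitPart restPart : ∀ {k} → Vec ℕ k → Vec ℕ k
unitPart = map (1 ⊓_)
restPart = map (_∸ 1)

unit⊕rest : ∀ {k} (v : Vec ℕ k) → unitPart v ⊕ restPart v ≡ v
unit⊕rest []      = refl
unit⊕rest (x ∷ v) = cong₂ _∷_ (m⊓n+n∸m≡n 1 x) (unit⊕rest v)

Bounded : ∀ {k} → ℕ → Vec ℕ k → Set
Bounded N = All (_≤ N)

unitPart-bounded : ∀ {k} (v : Vec ℕ k) → Bounded 1 (unitPart v)
unitPart-bounded []      = []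
unitPart-bounded (x ∷ v) = m⊓n≤m 1 x ∷ unitPart-bounded v

restPart-bounded : ∀ {k N} {v : Vec ℕ k} → Bounded (suc N) v → Bounded N (restPart v)
restPart-bounded b = map⁺ (All.map (∸-monoˡ-≤ 1) b)

bounded-by-sum : ∀ {k} (v : Vec ℕ k) → Bounded (sum v) v
bounded-by-sum []      = []
bounded-by-sum (x ∷ v) =
  m≤m+n x (sum v) ∷ All.map (λ p → ≤-trans p (m≤n+m (sum v) x)) (bounded-by-sum v)

midpoint : ∀ {k} → Vec ℕ k → Vec ℚ k
midpoint = map half
  where
  half : ℕ → ℚ
  half zero    = 0ℚ
  half (suc _) = ½

midpoint-floor : ∀ {k} {v : Vec ℕ k} → Bounded 1 v → ⌊ midpoint v ⌋ᵛ ≡ replicate k 0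
midpoint-floor []             = refl
midpoint-floor (z≤n     ∷ b) = cong (0 ∷_) (midpoint-floor b)
midpoint-floor (s≤s z≤n ∷ b) = cong (0 ∷_) (midpoint-floor b)

midpoint-ceiling : ∀ {k} {v : Vec ℕ k} → Bounded 1 v → ⌈ midpoint v ⌉ᵛ ≡ v
midpoint-ceiling []             = refl
midpoint-ceiling (z≤n     ∷ b) = cong (0 ∷_) (midpoint-ceiling b)
midpoint-ceiling (s≤s z≤n ∷ b) = cong (1 ∷_) (midpoint-ceiling b)

midpoint-inBox : ∀ {k} {v : Vec ℕ k} → Bounded 1 v → InBox (midpoint v) v
midpoint-inBox (z≤n     ∷ b) Fin.zero    = ℚ.≤-refl , ℚ.≤-refl
midpoint-inBox (s≤s z≤n ∷ b) Fin.zero    =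
  toWitness {a? = 0ℚ ℚ.≤? ½} tt , toWitness {a? = ½ ℚ.≤? 1ℚ} tt
midpoint-inBox (_       ∷ b) (Fin.suc i) = midpoint-inBox b i

module _ {k : ℕ} (Γ : KGraph k) where

  arrow : ∀ {a b} → Hom Γ a b → Mor Γ
  arrow {a} {b} f = a , b , f

  -- By unique factorisation (f = id ∘ f = f ∘ id), a morphism of degree 0
  -- is an identity.
  degree-zero-is-id : ∀ {p q} (f : Hom Γ p q) → d Γ f ≡ replicate k 0 →
                      arrow f ≡ arrow (id Γ {q})
  degree-zero-is-id {p} {q} f e
    with factor-unique Γ f (replicate k 0) (replicate k 0)
           (q , id Γ , f , d-id Γ , e , identityˡ Γ f)
           (p , f , id Γ , e , d-id Γ , identityʳ Γ f)
  ... | refl = refl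

  strip-identities : ∀ {a c x y} {α : Hom Γ y c} {β : Hom Γ x y} {γ : Hom Γ a x} →
                     arrow α ≡ arrow (id Γ {c}) → arrow γ ≡ arrow (id Γ {x}) →
                     arrow (_∘_ Γ α (_∘_ Γ β γ)) ≡ arrow β
  strip-identities {β = β} refl refl =
    cong arrow (trans (identityˡ Γ _) (identityʳ Γ β))

  full-segment : ∀ {a c} (f : Hom Γ a c) (β : Mor Γ) →
                 IsSeg Γ f (replicate k 0) (d Γ f) β → arrow f ≡ β
  full-segment f (x , y , β) (α , γ , dα , dβ , eq) =
    trans (cong arrow (sym eq))
          (strip-identities (degree-zero-is-id α dα) (degree-zero-is-id γ dγ))
    where
    open ≡-Reasoning
    dβ≡df : d Γ β ≡ d Γ f
    dβ≡df = trans (sym (0⊕ (d Γ β))) dβ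
    -- degrees add up to d(f) = 0 + d(f) + d(γ), so d(γ) = 0
    dγ : d Γ γ ≡ replicate k 0
    dγ = ⊕-cancelˡ (d Γ f) (begin
      d Γ f ⊕ d Γ γ                        ≡⟨ cong (_⊕ d Γ γ) (sym dβ≡df) ⟩
      d Γ β ⊕ d Γ γ                        ≡⟨ sym (d-∘ Γ β γ) ⟩
      d Γ (_∘_ Γ β γ)                      ≡⟨ sym (0⊕ _) ⟩
      replicate k 0 ⊕ d Γ (_∘_ Γ β γ)      ≡⟨ cong (_⊕ d Γ (_∘_ Γ β γ)) (sym dα) ⟩
      d Γ α ⊕ d Γ (_∘_ Γ β γ)              ≡⟨ sym (d-∘ Γ α _) ⟩
      d Γ (_∘_ Γ α (_∘_ Γ β γ))            ≡⟨ cong (d Γ) eq ⟩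
      d Γ f                                ≡⟨ sym (⊕0 (d Γ f)) ⟩
      d Γ f ⊕ replicate k 0                ∎)

  ∘-cong : ∀ {a b c a' b' c'} {f : Hom Γ a b} {g : Hom Γ b c}
             {f' : Hom Γ a' b'} {g' : Hom Γ b' c'} →
           arrow g ≡ arrow g' → arrow f ≡ arrow f' →
           arrow (_∘_ Γ g f) ≡ arrow (_∘_ Γ g' f')
  ∘-cong refl refl = refl

module _ {k : ℕ} {Λ Γ : KGraph k} (φ ψ : KMorphism Λ Γ) where

  AgreeOn : ∀ {a b} → Hom Λ a b → Set
  AgreeOn λ' = arrow Γ (F₁ φ λ') ≡ arrow Γ (F₁ ψ λ')

  -- φ̃ = ψ̃ at the midpoint of a unit morphism λ: both φ(λ) and ψ(λ) equal
  -- the common segment of degree d(λ) at that point.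
  agree-on-units : TildeEq φ ψ →
                   ∀ {a b} (λ' : Hom Λ a b) → Bounded 1 (d Λ λ') → AgreeOn λ'
  agree-on-units tilde λ' unit
    with tilde λ' (midpoint (d Λ λ')) (midpoint-inBox unit)
  ... | β , (segφ , segψ) , _ =
    trans (full-segment Γ (F₁ φ λ') β (as-full-segment φ segφ))
          (sym (full-segment Γ (F₁ ψ λ') β (as-full-segment ψ segψ)))
    where
    as-full-segment : (χ : KMorphism Λ Γ) →
      IsSeg Γ (F₁ χ λ') ⌊ midpoint (d Λ λ') ⌋ᵛ ⌈ midpoint (d Λ λ') ⌉ᵛ β →
      IsSeg Γ (F₁ χ λ') (replicate k 0) (d Γ (F₁ χ λ')) β
    as-full-segment χ =
      subst₂ (λ m n → IsSeg Γ (F₁ χ λ') m n β)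
             (midpoint-floor unit)
             (trans (midpoint-ceiling unit) (sym (F-d χ λ')))

  -- Agreement on unit morphisms propagates to all morphisms of degree
  -- bounded by N + 1: factor λ = μ ∘ ν with d(μ) = unitPart and
  -- d(ν) = restPart, whose bound is one smaller.
  agree-bounded : (∀ {a b} (λ' : Hom Λ a b) → Bounded 1 (d Λ λ') → AgreeOn λ') →
                  ∀ N {a b} (λ' : Hom Λ a b) → Bounded (suc N) (d Λ λ') → AgreeOn λ'
  agree-bounded units zero    λ' bound = units λ' bound
  agree-bounded units (suc N) λ' bound
    with factor Λ λ' (unitPart (d Λ λ')) (restPart (d Λ λ')) (sym (unit⊕rest (d Λ λ')))
  ... | _ , μ , ν , dμ , dν , refl =
    subst₂ (λ f g → arrow Γ f ≡ arrow Γ g) (sym (F-∘ φ μ ν)) (sym (F-∘ ψ μ ν))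
      (∘-cong Γ (units μ (subst (Bounded 1) (sym dμ) (unitPart-bounded (d Λ λ'))))
                (agree-bounded units N ν
                   (subst (Bounded (suc N)) (sym dν) (restPart-bounded bound))))

  agree-from-units : (∀ {a b} (λ' : Hom Λ a b) → Bounded 1 (d Λ λ') → AgreeOn λ') →
                     ∀ {a b} (λ' : Hom Λ a b) → AgreeOn λ'
  agree-from-units units λ' =
    agree-bounded units (sum (d Λ λ')) λ'
      (All.map (λ p → ≤-trans p (n≤1+n _)) (bounded-by-sum (d Λ λ')))

mainTheorem16 : ∀ {k : ℕ} {Λ Γ : KGraph k} (φ ψ : KMorphism Λ Γ) →
                TildeEq φ ψ → MorphEq φ ψ
mainTheorem16 {Λ = Λ} φ ψ tilde = on-objects , agree
  where
  agree : ∀ {a b} (λ' : Hom Λ a b) → AgreeOn φ ψ λ'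
  agree = agree-from-units φ ψ (agree-on-units φ ψ tilde)

  -- an object is the source of its identity morphism
  on-objects : ∀ a → F₀ φ a ≡ F₀ ψ a
  on-objects a = cong proj₁ (agree (id Λ {a}))
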